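{- Let $m$ be a positive integer and $p$ a positive integer which is a multiple of $m$ if $m$ is odd, and a multiple of $2m$ if $m$ is even. Let $S$ be a $p$-periodic doubly infinite sequence of elements of $\mathbb{Z}/m\mathbb{Z}$ whose orbit is periodic of period $(p,p)$. Then the triangles $\nabla(S[\lambda p])$ are balanced for all non-negative integers $\lambda$ if and only if there exist two distinct positive integers $\lambda_1,\lambda_2$ such that $\nabla(S[\lambda_1p])$ and $\nabla(S[\lambda_2p])$ are balanced.
   Context: A sequence $(u_j)_{j\in\mathbb{Z}}$ is $p$-periodic if $u_{j+p}=u_j$ for all $j$. Its orbit is $(a_{i,j})_{(i,j)\in\mathbb{N}\times\mathbb{Z}}$ with $a_{0,j}=u_j$ and $a_{i,j}=-a_{i-1,j}-a_{i-1,j+1}$ for $i\ge1$; it is periodic of period $(p,q)$ if $a_{i+q,j}=a_{i,j+p}=a_{i,j}$ for all $(i,j)$. $S[n]=(u_0,\dots,u_{n-1})$. For a finite tuple $(u_0,\dots,u_{n-1})$, $\nabla(u_0,\dots,u_{n-1})$ is the multiset $(a_{i,j})_{i,j\ge0,\,i+j<n}$ defined by the same rule; it is balanced if all elements of $\mathbb{Z}/m\mathbb{Z}$ occur in it with the same multiplicity. -}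

module Defs where

open import Data.Nat using (ℕ; zero; suc; _+_; _*_; _%_; NonZero)
open import Data.Nat.DivMod using (_mod_)
open import Data.Integer as ℤ using (ℤ)
open import Data.Fin as Fin using (Fin; toℕ)
open import Data.Bool using (Bool; true; false; if_then_else_)
open import Relation.Nullary.Decidable using (⌊_⌋)
open import Relation.Binary.PropositionalEquality using (_≡_)

-- Elements of ℤ/mℤ are represented by Fin m (residues 0..m-1),
-- with addition and negation taken modulo m.
module _ (m : ℕ) .{{_ : NonZero m}} where

  addMod : Fin m → Fin m → Fin m
  addMod x y = (toℕ x + toℕ y) mod m

  negMod : Fin m → Fin m
  negMod x = (m Data.Nat.∸ toℕ x) mod m

  orbit : (ℤ → Fin m) → ℕ → ℤ → Fin m
  orbit u zero    j = u j
  orbit u (suc i) j = negMod (addMod (orbit u i j) (orbit u i (j ℤ.+ ℤ.+ 1)))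

  Periodic : ℕ → (ℤ → Fin m) → Set
  Periodic p u = ∀ j → u (j ℤ.+ ℤ.+ p) ≡ u j

  OrbitPeriodic : (ℤ → Fin m) → ℕ → ℕ → Set
  OrbitPeriodic u p q =
    ∀ (i : ℕ) (j : ℤ) →
      (orbit u (i + q) j ≡ orbit u i j) × (orbit u i (j ℤ.+ ℤ.+ p) ≡ orbit u i j)
    where open import Data.Product using (_×_)

  -- a finite tuple (u_0,…,u_{n-1}) given as a function of index
  -- triangle ∇(w_0,…,w_{n-1}) computed from w : ℕ → Fin m (only w_0..w_{n-1} matter)
  tri : (ℕ → Fin m) → ℕ → ℕ → Fin m
  tri w zero    j = w j
  tri w (suc i) j = negMod (addMod (tri w i j) (tri w i (suc j)))

  countRow : (ℕ → Fin m) → Fin m → ℕ → ℕ → ℕ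
  countRow w x i zero    = 0
  countRow w x i (suc k) =
    countRow w x i k + (if ⌊ tri w i k Fin.≟ x ⌋ then 1 else 0)

  countTri : (ℕ → Fin m) → Fin m → ℕ → ℕ → ℕ
  countTri w x n zero    = 0
  countTri w x n (suc k) = countTri w x n k + countRow w x k (n Data.Nat.∸ k)

  multiplicity : (ℕ → Fin m) → ℕ → Fin m → ℕ
  multiplicity w n x = countTri w x n n

  Balanced : (ℕ → Fin m) → ℕ → Set
  Balanced w n = ∀ x y → multiplicity w n x ≡ multiplicity w n y

  prefix : (ℤ → Fin m) → ℕ → Fin m
  prefix u j = u (ℤ.+ j)

{-# OPTIONS --safe #-}
module Submission where

-- Fix a value x and let M(l) be its multiplicity in ∇(S[lp]). As the orbit is
-- (p,p)-periodic, the rows i < p of ∇(S[(l+1)p]) are l full periods followed by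
-- row i of ∇(S[p]), and the rows i ≥ p form a copy of ∇(S[lp]). Hence
-- M(l+1) = M(l) + l B + T, with B and T the counts of x in a p × p block and in
-- ∇(S[p]), so 2 M(k+1) = (k+1)(k B + 2 T). Equality of M for two values x, y at two
-- distinct positive multiples of p forces equal B and T, hence equal M everywhere.

open import Defs
open import Data.Nat using (ℕ; _*_; _<_; NonZero)
open import Data.Nat.Divisibility using (_∣_; _∤_)
open import Relation.Binary.PropositionalEquality using (_≢_)
open import Data.Integer using (ℤ)
open import Data.Fin using (Fin)
open import Data.Product using (_×_; ∃-syntax)
open import Function.Bundles using (_⇔_)

open import Data.Nat using (zero; suc; _+_; _∸_; s≤s; z≤n)
open import Data.Nat.Properties
open import Data.Nat.Tactic.RingSolver using (solve-∀)
open import Algebra.Properties.CommutativeSemigroup +-commutativeSemigroup using (interchange)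
import Data.Integer as ℤ
import Data.Fin as Fin
open import Data.Bool using (if_then_else_)
open import Data.Product using (_,_; proj₁; proj₂)
open import Function.Bundles using (mk⇔)
open import Function.Base using (_∘_)
open import Relation.Nullary.Decidable using (⌊_⌋)
open import Relation.Binary.PropositionalEquality
  using (_≡_; refl; sym; trans; cong; cong₂; subst; module ≡-Reasoning)
open import Relation.Binary.Definitions using (tri<; tri≈; tri>)
open import Relation.Nullary.Negation using (contradiction)

open ≡-Reasoning

sumBelow : (ℕ → ℕ) → ℕ → ℕ
sumBelow g zero    = 0
sumBelow g (suc n) = sumBelow g n + g n

sumBelow-cong< : ∀ {g h} n → (∀ i → i < n → g i ≡ h i) → sumBelow g n ≡ sumBelow h n
sumBelow-cong< zero    eq = refl
sumBelow-cong< (suc n) eq =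
  cong₂ _+_ (sumBelow-cong< n (λ i i<n → eq i (m<n⇒m<1+n i<n))) (eq n (n<1+n n))

sumBelow-cong : ∀ {g h} n → (∀ i → g i ≡ h i) → sumBelow g n ≡ sumBelow h n
sumBelow-cong n eq = sumBelow-cong< n (λ i _ → eq i)

sumBelow-split : ∀ g a b → sumBelow g (a + b) ≡ sumBelow g a + sumBelow (λ j → g (a + j)) b
sumBelow-split g a zero    = trans (cong (sumBelow g) (+-identityʳ a)) (sym (+-identityʳ _))
sumBelow-split g a (suc b) = begin
  sumBelow g (a + suc b)                                         ≡⟨ cong (sumBelow g) (+-suc a b) ⟩
  sumBelow g (a + b) + g (a + b)                                 ≡⟨ cong (_+ g (a + b)) (sumBelow-split g a b) ⟩
  sumBelow g a + sumBelow (λ j → g (a + j)) b + g (a + b)        ≡⟨ +-assoc (sumBelow g a) _ _ ⟩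
  sumBelow g a + sumBelow (λ j → g (a + j)) (suc b)              ∎

sumBelow-+ : ∀ g h n → sumBelow (λ i → g i + h i) n ≡ sumBelow g n + sumBelow h n
sumBelow-+ g h zero    = refl
sumBelow-+ g h (suc n) = begin
  sumBelow (λ i → g i + h i) n + (g n + h n)        ≡⟨ cong (_+ (g n + h n)) (sumBelow-+ g h n) ⟩
  sumBelow g n + sumBelow h n + (g n + h n)         ≡⟨ interchange (sumBelow g n) _ _ _ ⟩
  sumBelow g n + g n + (sumBelow h n + h n)         ∎

sumBelow-*ˡ : ∀ c g n → sumBelow (λ i → c * g i) n ≡ c * sumBelow g n
sumBelow-*ˡ c g zero    = sym (*-zeroʳ c)
sumBelow-*ˡ c g (suc n) = trans (cong (_+ c * g n) (sumBelow-*ˡ c g n))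
                                (sym (*-distribˡ-+ c (sumBelow g n) (g n)))

module PeriodicSum {g : ℕ → ℕ} {p : ℕ} (periodic : ∀ j → g (p + j) ≡ g j) where

  shift-multiple : ∀ l j → g (l * p + j) ≡ g j
  shift-multiple zero    j = refl
  shift-multiple (suc l) j = trans (cong g (+-assoc p (l * p) j))
                                   (trans (periodic _) (shift-multiple l j))

  sumBelow-multiple : ∀ l → sumBelow g (l * p) ≡ l * sumBelow g p
  sumBelow-multiple zero    = refl
  sumBelow-multiple (suc l) = begin
    sumBelow g (p + l * p)                          ≡⟨ sumBelow-split g p (l * p) ⟩
    sumBelow g p + sumBelow (λ j → g (p + j)) (l * p) ≡⟨ cong (sumBelow g p +_) (sumBelow-cong (l * p) periodic) ⟩
    sumBelow g p + sumBelow g (l * p)               ≡⟨ cong (sumBelow g p +_) (sumBelow-multiple l) ⟩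
    sumBelow g p + l * sumBelow g p                 ∎

triangleSum : (ℕ → ℕ → ℕ) → ℕ → ℕ
triangleSum f n = sumBelow (λ i → sumBelow (f i) (n ∸ i)) n

squareSum : (ℕ → ℕ → ℕ) → ℕ → ℕ
squareSum f n = sumBelow (λ i → sumBelow (f i) n) n

triangleSum-step : ∀ (f : ℕ → ℕ → ℕ) p →
  (∀ i j → f (p + i) j ≡ f i j) → (∀ i j → f i (p + j) ≡ f i j) →
  ∀ l → triangleSum f (p + l * p) ≡ triangleSum f (l * p) + l * squareSum f p + triangleSum f p
triangleSum-step f p periodicᵢ periodicⱼ l = begin
  triangleSum f (p + n)                                           ≡⟨ sumBelow-split _ p n ⟩
  sumBelow (λ i → sumBelow (f i) (p + n ∸ i)) p
    + sumBelow (λ i → sumBelow (f (p + i)) (p + n ∸ (p + i))) n   ≡⟨ cong₂ _+_ top-rows bottom-rows ⟩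
  l * squareSum f p + triangleSum f p + triangleSum f n           ≡⟨ +-comm _ (triangleSum f n) ⟩
  triangleSum f n + (l * squareSum f p + triangleSum f p)         ≡⟨ +-assoc (triangleSum f n) _ _ ⟨
  triangleSum f n + l * squareSum f p + triangleSum f p           ∎
  where
  n : ℕ
  n = l * p

  top-row : ∀ i → i < p → sumBelow (f i) (p + n ∸ i) ≡ l * sumBelow (f i) p + sumBelow (f i) (p ∸ i)
  top-row i i<p = begin
    sumBelow (f i) (p + n ∸ i)                                     ≡⟨ cong (sumBelow (f i)) (trans (+-∸-comm n (<⇒≤ i<p)) (+-comm (p ∸ i) n)) ⟩
    sumBelow (f i) (n + (p ∸ i))                                   ≡⟨ sumBelow-split (f i) n (p ∸ i) ⟩
    sumBelow (f i) n + sumBelow (λ j → f i (n + j)) (p ∸ i)        ≡⟨ cong₂ _+_ (sumBelow-multiple l) (sumBelow-cong (p ∸ i) (shift-multiple l)) ⟩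
    l * sumBelow (f i) p + sumBelow (f i) (p ∸ i)                  ∎
    where open PeriodicSum (periodicⱼ i)

  top-rows : sumBelow (λ i → sumBelow (f i) (p + n ∸ i)) p ≡ l * squareSum f p + triangleSum f p
  top-rows = begin
    sumBelow (λ i → sumBelow (f i) (p + n ∸ i)) p                           ≡⟨ sumBelow-cong< p top-row ⟩
    sumBelow (λ i → l * sumBelow (f i) p + sumBelow (f i) (p ∸ i)) p        ≡⟨ sumBelow-+ _ _ p ⟩
    sumBelow (λ i → l * sumBelow (f i) p) p + triangleSum f p               ≡⟨ cong (_+ triangleSum f p) (sumBelow-*ˡ l _ p) ⟩
    l * squareSum f p + triangleSum f p                                     ∎

  bottom-rows : sumBelow (λ i → sumBelow (f (p + i)) (p + n ∸ (p + i))) n ≡ triangleSum f n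
  bottom-rows = sumBelow-cong n λ i →
    trans (cong (sumBelow (f (p + i))) ([m+n]∸[m+o]≡n∸o p n i)) (sumBelow-cong (n ∸ i) (periodicᵢ i))

quadratic : ℕ → ℕ → ℕ → ℕ
quadratic B T zero    = 0
quadratic B T (suc l) = quadratic B T l + l * B + T

2*quadratic : ∀ B T k → 2 * quadratic B T (suc k) ≡ suc k * (k * B + 2 * T)
2*quadratic B T zero    = base B T
  where
  base : ∀ B T → 2 * (0 + 0 * B + T) ≡ 1 * (0 * B + 2 * T)
  base = solve-∀
2*quadratic B T (suc k) = begin
  2 * (q + suc k * B + T)                   ≡⟨ distrib q k B T ⟩
  2 * q + 2 * (suc k * B + T)               ≡⟨ cong (_+ 2 * (suc k * B + T)) (2*quadratic B T k) ⟩
  suc k * (k * B + 2 * T) + 2 * (suc k * B + T) ≡⟨ regroup k B T ⟩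
  suc (suc k) * (suc k * B + 2 * T)         ∎
  where
  q : ℕ
  q = quadratic B T (suc k)
  distrib : ∀ q k B T → 2 * (q + suc k * B + T) ≡ 2 * q + 2 * (suc k * B + T)
  distrib = solve-∀
  regroup : ∀ k B T → suc k * (k * B + 2 * T) + 2 * (suc k * B + T) ≡ suc (suc k) * (suc k * B + 2 * T)
  regroup = solve-∀

slope-unique : ∀ k d {a a′ b b′} → k * a + b ≡ k * a′ + b′ →
  suc (k + d) * a + b ≡ suc (k + d) * a′ + b′ → a ≡ a′
slope-unique k d {a} {a′} {b} {b′} e₁ e₂ = *-cancelˡ-≡ a a′ (suc d) (+-cancelʳ-≡ _ _ _ (begin
  suc d * a + (k * a′ + b′)     ≡⟨ cong (suc d * a +_) e₁ ⟨
  suc d * a + (k * a + b)       ≡⟨ split k d a b ⟨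
  suc (k + d) * a + b           ≡⟨ e₂ ⟩
  suc (k + d) * a′ + b′         ≡⟨ split k d a′ b′ ⟩
  suc d * a′ + (k * a′ + b′)    ∎))
  where
  split : ∀ k d a b → suc (k + d) * a + b ≡ suc d * a + (k * a + b)
  split = solve-∀

affine-coefficients-unique : ∀ {k₁ k₂ a a′ b b′} → k₁ ≢ k₂ →
  k₁ * a + b ≡ k₁ * a′ + b′ → k₂ * a + b ≡ k₂ * a′ + b′ → a ≡ a′ × b ≡ b′
affine-coefficients-unique {k₁} {k₂} {a} {a′} {b} {b′} k₁≢k₂ e₁ e₂ =
  a≡a′ , +-cancelˡ-≡ (k₁ * a) b b′ (trans e₁ (cong (λ x → k₁ * x + b′) (sym a≡a′)))
  where
  a≡a′ : a ≡ a′
  a≡a′ with <-cmp k₁ k₂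
  ... | tri< k₁<k₂ _ _ = let d , eq = m≤n⇒∃[o]m+o≡n k₁<k₂ in
                         slope-unique k₁ d e₁ (subst (λ k → k * a + b ≡ k * a′ + b′) (sym eq) e₂)
  ... | tri≈ _ k₁≡k₂ _ = contradiction k₁≡k₂ k₁≢k₂
  ... | tri> _ _ k₂<k₁ = let d , eq = m≤n⇒∃[o]m+o≡n k₂<k₁ in
                         slope-unique k₂ d e₂ (subst (λ k → k * a + b ≡ k * a′ + b′) (sym eq) e₁)

quadratic-coefficients-unique : ∀ {B B′ T T′ k₁ k₂} → k₁ ≢ k₂ →
  quadratic B T (suc k₁) ≡ quadratic B′ T′ (suc k₁) →
  quadratic B T (suc k₂) ≡ quadratic B′ T′ (suc k₂) → B ≡ B′ × T ≡ T′
quadratic-coefficients-unique {B} {B′} {T} {T′} {k₁} {k₂} k₁≢k₂ e₁ e₂ =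
  let B≡B′ , 2T≡2T′ = affine-coefficients-unique k₁≢k₂ (affine k₁ e₁) (affine k₂ e₂)
  in B≡B′ , *-cancelˡ-≡ T T′ 2 2T≡2T′
  where
  affine : ∀ k → quadratic B T (suc k) ≡ quadratic B′ T′ (suc k) → k * B + 2 * T ≡ k * B′ + 2 * T′
  affine k e = *-cancelˡ-≡ _ _ (suc k)
    (trans (sym (2*quadratic B T k)) (trans (cong (2 *_) e) (2*quadratic B′ T′ k)))

module _ (m : ℕ) .{{_ : NonZero m}} where

  δ : Fin m → Fin m → ℕ
  δ x a = if ⌊ a Fin.≟ x ⌋ then 1 else 0

  indicator : (ℕ → Fin m) → Fin m → ℕ → ℕ → ℕ
  indicator w x i j = δ x (tri m w i j)

  countRow≡sumBelow : ∀ w x i k → countRow m w x i k ≡ sumBelow (indicator w x i) k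
  countRow≡sumBelow w x i zero    = refl
  countRow≡sumBelow w x i (suc k) = cong (_+ indicator w x i k) (countRow≡sumBelow w x i k)

  countTri≡sumBelow : ∀ w x n k →
    countTri m w x n k ≡ sumBelow (λ i → sumBelow (indicator w x i) (n ∸ i)) k
  countTri≡sumBelow w x n zero    = refl
  countTri≡sumBelow w x n (suc k) =
    cong₂ _+_ (countTri≡sumBelow w x n k) (countRow≡sumBelow w x k (n ∸ k))

  multiplicity≡triangleSum : ∀ w n x → multiplicity m w n x ≡ triangleSum (indicator w x) n
  multiplicity≡triangleSum w n x = countTri≡sumBelow w x n n

  tri-prefix≡orbit : ∀ S i j → tri m (prefix m S) i j ≡ orbit m S i (ℤ.+ j)
  tri-prefix≡orbit S zero    j = refl
  tri-prefix≡orbit S (suc i) j = cong (negMod m) (cong₂ (addMod m)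
    (tri-prefix≡orbit S i j)
    (trans (tri-prefix≡orbit S i (suc j)) (cong (λ k → orbit m S i (ℤ.+ k)) (+-comm 1 j))))

  module _ {S : ℤ → Fin m} {p : ℕ} (orbit-periodic : OrbitPeriodic m S p p) where

    private
      w : ℕ → Fin m
      w = prefix m S

    tri-prefix-periodicᵢ : ∀ i j → tri m w (p + i) j ≡ tri m w i j
    tri-prefix-periodicᵢ i j = begin
      tri m w (p + i) j          ≡⟨ tri-prefix≡orbit S (p + i) j ⟩
      orbit m S (p + i) (ℤ.+ j)  ≡⟨ cong (λ k → orbit m S k (ℤ.+ j)) (+-comm p i) ⟩
      orbit m S (i + p) (ℤ.+ j)  ≡⟨ proj₁ (orbit-periodic i (ℤ.+ j)) ⟩
      orbit m S i (ℤ.+ j)        ≡⟨ tri-prefix≡orbit S i j ⟨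
      tri m w i j                ∎

    tri-prefix-periodicⱼ : ∀ i j → tri m w i (p + j) ≡ tri m w i j
    tri-prefix-periodicⱼ i j = begin
      tri m w i (p + j)          ≡⟨ tri-prefix≡orbit S i (p + j) ⟩
      orbit m S i (ℤ.+ (p + j))  ≡⟨ cong (λ k → orbit m S i (ℤ.+ k)) (+-comm p j) ⟩
      orbit m S i (ℤ.+ (j + p))  ≡⟨ proj₂ (orbit-periodic i (ℤ.+ j)) ⟩
      orbit m S i (ℤ.+ j)        ≡⟨ tri-prefix≡orbit S i j ⟨
      tri m w i j                ∎

    multiplicity-quadratic : ∀ x l → multiplicity m w (l * p) x ≡
      quadratic (squareSum (indicator w x) p) (triangleSum (indicator w x) p) l
    multiplicity-quadratic x zero    = refl
    multiplicity-quadratic x (suc l) = begin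
      multiplicity m w (p + l * p) x            ≡⟨ multiplicity≡triangleSum w (p + l * p) x ⟩
      triangleSum χ (p + l * p)                 ≡⟨ triangleSum-step χ p periodicᵢ periodicⱼ l ⟩
      triangleSum χ (l * p) + l * B + T         ≡⟨ cong (λ c → c + l * B + T) (multiplicity≡triangleSum w (l * p) x) ⟨
      multiplicity m w (l * p) x + l * B + T    ≡⟨ cong (λ c → c + l * B + T) (multiplicity-quadratic x l) ⟩
      quadratic B T l + l * B + T               ∎
      where
      χ : ℕ → ℕ → ℕ
      χ = indicator w x
      B T : ℕ
      B = squareSum χ p
      T = triangleSum χ p
      periodicᵢ : ∀ i j → χ (p + i) j ≡ χ i j
      periodicᵢ i j = cong (δ x) (tri-prefix-periodicᵢ i j)
      periodicⱼ : ∀ i j → χ i (p + j) ≡ χ i j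
      periodicⱼ i j = cong (δ x) (tri-prefix-periodicⱼ i j)

    balanced-twice⇒balanced : ∀ {k₁ k₂} → k₁ ≢ k₂ →
      Balanced m w (suc k₁ * p) → Balanced m w (suc k₂ * p) → ∀ l → Balanced m w (l * p)
    balanced-twice⇒balanced {k₁} {k₂} k₁≢k₂ balanced₁ balanced₂ l x y = begin
      multiplicity m w (l * p) x   ≡⟨ multiplicity-quadratic x l ⟩
      quadratic B T l              ≡⟨ cong₂ (λ B T → quadratic B T l) (proj₁ coefficients) (proj₂ coefficients) ⟩
      quadratic B′ T′ l            ≡⟨ multiplicity-quadratic y l ⟨
      multiplicity m w (l * p) y   ∎
      where
      B T B′ T′ : ℕ
      B  = squareSum (indicator w x) p
      T  = triangleSum (indicator w x) p
      B′ = squareSum (indicator w y) p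
      T′ = triangleSum (indicator w y) p
      agree : ∀ k → Balanced m w (suc k * p) → quadratic B T (suc k) ≡ quadratic B′ T′ (suc k)
      agree k balanced = trans (sym (multiplicity-quadratic x (suc k)))
                               (trans (balanced x y) (multiplicity-quadratic y (suc k)))
      coefficients : B ≡ B′ × T ≡ T′
      coefficients = quadratic-coefficients-unique k₁≢k₂ (agree k₁ balanced₁) (agree k₂ balanced₂)

proposition14 : (m : ℕ) .{{_ : NonZero m}} (p : ℕ) → 0 < p →
    (2 ∤ m → m ∣ p) → (2 ∣ m → (2 * m) ∣ p) →
    (S : ℤ → Fin m) → Periodic m p S → OrbitPeriodic m S p p →
    ((∀ (λ′ : ℕ) → Balanced m (prefix m S) (λ′ * p)) ⇔
    (∃[ λ₁ ] ∃[ λ₂ ] (0 < λ₁ × 0 < λ₂ × λ₁ ≢ λ₂ ×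
    Balanced m (prefix m S) (λ₁ * p) × Balanced m (prefix m S) (λ₂ * p))))
proposition14 m p _ _ _ S _ orbit-periodic = mk⇔
  (λ balanced → 1 , 2 , s≤s z≤n , s≤s z≤n , (λ ()) , balanced 1 , balanced 2)
  λ { (suc k₁ , suc k₂ , _ , _ , λ₁≢λ₂ , balanced₁ , balanced₂) →
        balanced-twice⇒balanced m orbit-periodic (λ₁≢λ₂ ∘ cong suc) balanced₁ balanced₂ }
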